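{- Let $r$ be a positive integer, $n = 8r$, and let $H$ be the graph on the $n$ vertices $v_{i,j}$ ($1 \le i \le r$, $1 \le j \le 8$) whose edges are: for each $i$, the edges $v_{i,1}v_{i,2}$, $v_{i,1}v_{i,3}$, $v_{i,1}v_{i,4}$, $v_{i,2}v_{i,3}$, $v_{i,3}v_{i,4}$, $v_{i,2}v_{i,5}$, $v_{i,3}v_{i,6}$, $v_{i,4}v_{i,7}$, $v_{i,2}v_{i,7}$, $v_{i,5}v_{i,6}$, $v_{i,6}v_{i,7}$, $v_{i,5}v_{i,8}$, $v_{i,6}v_{i,8}$, $v_{i,7}v_{i,8}$; and, for each $1 \le i \le r-1$, the edge $v_{i,8}v_{i+1,8}$. Let $s = \chi_L(H)$. Then the partial list colouring conjecture holds for $H$: for every positive integer $t < s$, $\lambda_t(H) \geq \frac{tn}{s}$.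
   Context: For a graph $G$ and a positive integer $k$, a $k$-assignment is a function assigning to each vertex $v$ a list $l(v)$ of exactly $k$ colours. $G$ is $\mathcal{L}$-list colourable if there is a proper vertex colouring in which each vertex $v$ receives a colour from $l(v)$; $G$ is $k$-choosable if it is $\mathcal{L}$-list colourable for every $k$-assignment $\mathcal{L}$. The list chromatic number $\chi_L(G)$ is the least $k$ such that $G$ is $k$-choosable. For a $t$-assignment $\mathcal{L}_t$, $\lambda_{\mathcal{L}_t}(G)$ is the maximum number of vertices of an induced subgraph of $G$ that is $\mathcal{L}_t$-list colourable, and $\lambda_t(G) = \min\{\lambda_{\mathcal{L}_t}(G) : \mathcal{L}_t \text{ a } t\text{ -assignment for } G\}$. -}

module Defs where

open import Data.Nat using (ℕ; zero; suc; _*_; _≤_; _<_)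
open import Data.Fin using (Fin; toℕ; combine; #_; fromℕ)
open import Data.Fin.Subset using (Subset; _∈_; ∣_∣)
open import Data.Product using (Σ; ∃; ∃-syntax; _×_; _,_)
open import Data.Sum using (_⊎_)
open import Relation.Binary.PropositionalEquality using (_≡_; _≢_)
open import Relation.Nullary using (¬_)
open import Function.Definitions using (Injective)

record Graph (n : ℕ) : Set₁ where
  field
    Adj : Fin n → Fin n → Set

open Graph public

record Assignment {n : ℕ} (G : Graph n) (k : ℕ) : Set where
  field
    list     : Fin n → Fin k → ℕ
    distinct : ∀ v → Injective _≡_ _≡_ (list v)

open Assignment public

InducedListColourable : ∀ {n k} (G : Graph n) → Assignment G k → Subset n → Set
InducedListColourable {n} {k} G L S =
  Σ (Fin n → ℕ) λ c →
    (∀ v → v ∈ S → ∃[ i ] c v ≡ list L v i) ×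
    (∀ u v → u ∈ S → v ∈ S → Adj G u v → c u ≢ c v)

ListColourable : ∀ {n k} (G : Graph n) → Assignment G k → Set
ListColourable {n} G L =
  Σ (Fin n → ℕ) λ c →
    (∀ v → ∃[ i ] c v ≡ list L v i) ×
    (∀ u v → Adj G u v → c u ≢ c v)

Choosable : ∀ {n} → Graph n → ℕ → Set
Choosable G k = (L : Assignment G k) → ListColourable G L

IsListChromaticNumber : ∀ {n} → Graph n → ℕ → Set
IsListChromaticNumber G s = Choosable G s × (∀ k → k < s → ¬ Choosable G k)

-- λ_t(G) ≥ p / q  (q > 0), unfolded through the definition
-- λ_t(G) = min_L λ_L(G), λ_L(G) = max size of an L-list colourable induced
-- subgraph: for every t-assignment L there is an induced subgraph G[S]
-- that is L-list colourable with |S| ≥ p / q, i.e. p ≤ q * |S|.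
LambdaAtLeastRatio : ∀ {n} → Graph n → (t p q : ℕ) → Set
LambdaAtLeastRatio {n} G t p q =
  (L : Assignment G t) → ∃[ S ] (p ≤ q * ∣ S ∣ × InducedListColourable G L S)

-- The 14 edges inside one 8-vertex gadget (0-indexed: v_{i,j} ↦ j-1).
data E8 : Fin 8 → Fin 8 → Set where
  e12 : E8 (# 0) (# 1)
  e13 : E8 (# 0) (# 2)
  e14 : E8 (# 0) (# 3)
  e23 : E8 (# 1) (# 2)
  e34 : E8 (# 2) (# 3)
  e25 : E8 (# 1) (# 4)
  e36 : E8 (# 2) (# 5)
  e47 : E8 (# 3) (# 6)
  e27 : E8 (# 1) (# 6)
  e56 : E8 (# 4) (# 5)
  e67 : E8 (# 5) (# 6)
  e58 : E8 (# 4) (# 7)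
  e68 : E8 (# 5) (# 7)
  e78 : E8 (# 6) (# 7)

-- Directed edge list of H (each edge once); vertex v_{i,j} is
-- combine i j : Fin (r * 8)  (0-indexed i, j).
data HEdge (r : ℕ) : Fin (r * 8) → Fin (r * 8) → Set where
  inner : (i : Fin r) (j j' : Fin 8) → E8 j j' → HEdge r (combine i j) (combine i j')
  outer : (i i' : Fin r) → toℕ i' ≡ suc (toℕ i) →
          HEdge r (combine i (fromℕ 7)) (combine i' (fromℕ 7))

H : (r : ℕ) → Graph (r * 8)
H r = record { Adj = λ u v → HEdge r u v ⊎ HEdge r v u }

-- Every t-assignment is coloured gadget by gadget.  For t = 1 take the
-- independent set {v₁, v₅, v₇} of each gadget, for t = 3 colour v₂, …, v₇
-- greedily, and for t ≥ 4 colour everything: first the path of the vertices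
-- v₈ (lists of size ≥ 2), then each gadget greedily.  This gives 3r, 6r and
-- 8r vertices.  Since the triangle v₁v₂v₃ makes H not 2-choosable, s ≥ 3,
-- and together with t < s these counts reach tn/s.
--
-- For t = 2 each gadget has one of two colourable 6-vertex induced
-- subgraphs: A on {v₁, v₂, v₄, v₅, v₆, v₇} (two 4-cycles v₂v₁v₄v₇ and
-- v₂v₅v₆v₇ sharing the edge v₂v₇) or B on {v₁, v₂, v₃, v₄, v₅, v₇}.  Once
-- v₂ and v₇ are coloured, a path v₂ u w v₇ is blocked only if
-- L(u) = {c(v₂), a} and L(w) = {c(v₇), a}, so each of the two paths blocks at
-- most one pair (c(v₂), c(v₇)).  Hence A fails only if L(v₂) = L(v₇) = {x, x'}
-- and the paths block (x, x') and (x', x); then v₂ ↦ x', v₇ ↦ x extends to B.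

module Submission where

open import Data.Bool using (true; false)
open import Data.Empty using (⊥-elim)
open import Data.Fin using (Fin; zero; suc; #_; toℕ; combine; remQuot; fromℕ<; opposite)
open import Data.Fin.Properties
  using (toℕ-injective; remQuot-combine; pigeonhole; <-irrefl; ¬∀⟶∃¬; opposite-involutive; 0≢1+n)
open import Data.Fin.Subset using (Subset; _∈_; ∣_∣; inside; outside; ⊤)
open import Data.List using (List; []; _∷_; [_]; length)
open import Data.List.Relation.Unary.All using (All; head; tail)
open import Data.List.Relation.Unary.All.Properties using (¬Any⇒All¬)
open import Data.List.Relation.Unary.Any using (Any; here; index; any?)
open import Data.List.Relation.Unary.Any.Properties using (lookup-index)
open import Data.Nat using (ℕ; zero; suc; _+_; _*_; _≤_; _<_; z≤n; s≤s; _≟_)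
open import Data.Nat.Properties
  using ( *-commutativeSemigroup; ≤-refl; ≤-trans; +-mono-≤; *-monoˡ-≤; *-monoʳ-≤; n≤1+n; m≤m+n; <⇒≤
        ; suc-injective; module ≤-Reasoning)
open import Data.Product using (Σ-syntax; ∃-syntax; _×_; _,_; proj₁; proj₂; map₂; uncurry)
open import Data.Sum using (_⊎_; inj₁; inj₂)
open import Data.Vec using ([]; _∷_; _++_; lookup; concat; tabulate)
open import Data.Vec.Properties using (lookup-concat; lookup∘tabulate; []=⇒lookup)
open import Function using (_∘_)
open import Function.Definitions using (Injective)
open import Relation.Binary.PropositionalEquality
  using (_≡_; _≢_; refl; sym; trans; cong; subst₂; ≢-sym; module ≡-Reasoning)
open import Relation.Nullary using (¬_; yes; no)
open import Algebra.Properties.CommutativeSemigroup *-commutativeSemigroup using (x∙yz≈y∙xz)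

open import Defs

-- opaque: otherwise with-abstractions over fresh colours unfold the pigeonhole search
opaque
  fresh-colour : ∀ {t} (ℓ : Fin t → ℕ) → Injective _≡_ _≡_ ℓ →
                 (xs : List ℕ) → length xs < t → ∃[ q ] All (ℓ q ≢_) xs
  fresh-colour {t} ℓ ℓ-inj xs |xs|<t =
    map₂ (¬Any⇒All¬ xs) (¬∀⟶∃¬ t (λ q → Any (ℓ q ≡_) xs) (λ q → any? (ℓ q ≟_) xs) not-all-used)
    where
    not-all-used : ¬ (∀ q → Any (ℓ q ≡_) xs)
    not-all-used used with pigeonhole |xs|<t (λ q → index (used q))
    ... | q , q' , q<q' , same-position = <-irrefl (ℓ-inj ℓq≡ℓq') q<q'
      where
      open ≡-Reasoning
      ℓq≡ℓq' : ℓ q ≡ ℓ q'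
      ℓq≡ℓq' = begin
        ℓ q                                   ≡⟨ lookup-index (used q) ⟩
        Data.List.lookup xs (index (used q))  ≡⟨ cong (Data.List.lookup xs) same-position ⟩
        Data.List.lookup xs (index (used q')) ≡⟨ lookup-index (used q') ⟨
        ℓ q'                                  ∎

fresh-colour₁ : ∀ {t} {ℓ : Fin t → ℕ} → Injective _≡_ _≡_ ℓ → 2 ≤ t → (x : ℕ) → ∃[ q ] ℓ q ≢ x
fresh-colour₁ {ℓ = ℓ} ℓ-inj 2≤t x = map₂ head (fresh-colour ℓ ℓ-inj [ x ] 2≤t)

≢-in-a-coordinate : ∀ {u v x y : ℕ} → u ≢ x ⊎ v ≢ y → ¬ (x ≡ u × y ≡ v)
≢-in-a-coordinate (inj₁ u≢x) (x≡u , _) = u≢x (sym x≡u)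
≢-in-a-coordinate (inj₂ v≢y) (_ , y≡v) = v≢y (sym y≡v)

opposite-≢ : (k : Fin 2) → opposite k ≢ k
opposite-≢ zero ()
opposite-≢ (suc zero) ()

Fin2-cases : (k k' : Fin 2) → k' ≡ k ⊎ k' ≡ opposite k
Fin2-cases zero       zero       = inj₁ refl
Fin2-cases zero       (suc zero) = inj₂ refl
Fin2-cases (suc zero) zero       = inj₂ refl
Fin2-cases (suc zero) (suc zero) = inj₁ refl

Fin2-≢-unique : (a b c : Fin 2) → b ≢ a → c ≢ a → b ≡ c
Fin2-≢-unique a b c b≢a c≢a with Fin2-cases a b | Fin2-cases a c
... | inj₁ b≡a | _        = ⊥-elim (b≢a b≡a)
... | _        | inj₁ c≡a = ⊥-elim (c≢a c≡a)
... | inj₂ b≡ā | inj₂ c≡ā = trans b≡ā (sym c≡ā)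

-- A path x – u – w – y with precoloured ends and 2-lists U, W inside

PathColouring : (U W : Fin 2 → ℕ) (x y : ℕ) → Set
PathColouring U W x y = Σ[ i ∈ Fin 2 ] Σ[ j ∈ Fin 2 ] U i ≢ x × U i ≢ W j × W j ≢ y

PathBlocked : (U W : Fin 2 → ℕ) (x y : ℕ) → Set
PathBlocked U W x y =
  Σ[ k ∈ Fin 2 ] Σ[ m ∈ Fin 2 ] U k ≡ x × W m ≡ y × U (opposite k) ≡ W (opposite m)

module _ {U W : Fin 2 → ℕ} (U-inj : Injective _≡_ _≡_ U) where

  path-colouring-or-blocked : Injective _≡_ _≡_ W → ∀ x y → PathColouring U W x y ⊎ PathBlocked U W x y
  path-colouring-or-blocked W-inj x y
    with fresh-colour₁ U-inj ≤-refl x | fresh-colour₁ W-inj ≤-refl y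
  ... | i , Ui≢x | j , Wj≢y with U i ≟ W j
  ...   | no Ui≢Wj = inj₁ (i , j , Ui≢x , Ui≢Wj , Wj≢y)
  ...   | yes Ui≡Wj with U (opposite i) ≟ x | W (opposite j) ≟ y
  ...     | no Uī≢x | _ =
    inj₁ (opposite i , j , Uī≢x , (λ e → opposite-≢ i (U-inj (trans e (sym Ui≡Wj)))) , Wj≢y)
  ...     | yes _ | no Wj̄≢y =
    inj₁ (i , opposite j , Ui≢x , (λ e → opposite-≢ j (W-inj (trans (sym e) Ui≡Wj))) , Wj̄≢y)
  ...     | yes Uī≡x | yes Wj̄≡y = inj₂ (opposite i , opposite j , Uī≡x , Wj̄≡y , shared)
    where
    open ≡-Reasoning
    shared : U (opposite (opposite i)) ≡ W (opposite (opposite j))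
    shared = begin
      U (opposite (opposite i)) ≡⟨ cong U (opposite-involutive i) ⟩
      U i                       ≡⟨ Ui≡Wj ⟩
      W j                       ≡⟨ cong W (opposite-involutive j) ⟨
      W (opposite (opposite j)) ∎

  path-blocked-unique : ∀ {x y x' y'} → PathBlocked U W x y → PathBlocked U W x' y' →
                        x' ≢ y' → x ≡ x' × y ≡ y'
  path-blocked-unique (k , m , Uk≡x , Wm≡y , shared) (k' , m' , Uk'≡x' , Wm'≡y' , shared') x'≢y'
    with Fin2-cases k k' | Fin2-cases m m'
  ... | inj₁ refl | inj₁ refl = trans (sym Uk≡x) Uk'≡x' , trans (sym Wm≡y) Wm'≡y'
  ... | inj₁ refl | inj₂ refl = trans (sym Uk≡x) Uk'≡x' , (begin
    _                         ≡⟨ Wm≡y ⟨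
    W m                       ≡⟨ cong W (opposite-involutive m) ⟨
    W (opposite (opposite m)) ≡⟨ shared' ⟨
    U (opposite k)            ≡⟨ shared ⟩
    W (opposite m)            ≡⟨ Wm'≡y' ⟩
    _                         ∎)
    where open ≡-Reasoning
  ... | inj₂ refl | inj₁ refl = ⊥-elim (opposite-≢ k (U-inj (begin
    U (opposite k)            ≡⟨ shared ⟩
    W (opposite m)            ≡⟨ shared' ⟨
    U (opposite (opposite k)) ≡⟨ cong U (opposite-involutive k) ⟩
    U k                       ∎)))
    where open ≡-Reasoning
  ... | inj₂ refl | inj₂ refl = ⊥-elim (x'≢y' (trans (sym Uk'≡x') (trans shared Wm'≡y')))

-- Colourings of a single gadget; its vertex vₙ is # (n - 1), and subscripts
-- in names (c₅, k₅, Blocked₁₄, …) follow the paper's numbering.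

ProperOn : ∀ {t} (l : Fin 8 → Fin t → ℕ) → Subset 8 → (Fin 8 → Fin t) → Set
ProperOn l part choice =
  ∀ {j j'} → E8 j j' → lookup part j ≡ inside → lookup part j' ≡ inside →
  l j (choice j) ≢ l j' (choice j')

record GadgetColouring {t : ℕ} (l : Fin 8 → Fin t → ℕ) (k : ℕ) : Set where
  field
    part   : Subset 8
    size   : k ≤ ∣ part ∣
    choice : Fin 8 → Fin t
    proper : ProperOn l part choice

open GadgetColouring

GadgetColouringWithoutV₈ : ∀ {t} → (Fin 8 → Fin t → ℕ) → ℕ → Set
GadgetColouringWithoutV₈ l k = Σ[ g ∈ GadgetColouring l k ] lookup (part g) (# 7) ≢ inside

independent-part : Subset 8
independent-part = inside ∷ outside ∷ outside ∷ outside ∷ inside ∷ outside ∷ inside ∷ outside ∷ []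

independent-colouring : ∀ {t} (l : Fin 8 → Fin (suc t) → ℕ) → GadgetColouringWithoutV₈ l 3
independent-colouring l =
  record { part = independent-part ; size = ≤-refl ; choice = λ _ → zero ; proper = independent } , λ ()
  where
  independent : ProperOn l independent-part (λ _ → zero)
  independent e12 _ ()
  independent e13 _ ()
  independent e14 _ ()
  independent e23 () _
  independent e34 () _
  independent e25 () _
  independent e36 () _
  independent e47 () _
  independent e27 () _
  independent e56 _ ()
  independent e67 () _
  independent e58 _ ()
  independent e68 _ ()
  independent e78 _ ()

-- Each of v₇, v₆, v₅, v₂, v₃, v₄ has at most two neighbours coloured before it.
module Greedy {t : ℕ} (l : Fin 8 → Fin t → ℕ) (l-inj : ∀ j → Injective _≡_ _≡_ (l j))
              (3≤t : 3 ≤ t) (q₈ : Fin t) where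

  Fresh : Fin 8 → List ℕ → Set
  Fresh j xs = ∃[ q ] All (l j q ≢_) xs

  fresh : (j : Fin 8) (xs : List ℕ) → length xs < t → Fresh j xs
  fresh j = fresh-colour (l j) (l-inj j)

  c₈ : ℕ
  c₈ = l (# 7) q₈

  F₇ : Fresh (# 6) [ c₈ ]
  F₇ = fresh (# 6) _ (≤-trans (n≤1+n 2) 3≤t)
  c₇ : ℕ
  c₇ = l (# 6) (proj₁ F₇)

  F₆ : Fresh (# 5) (c₇ ∷ c₈ ∷ [])
  F₆ = fresh (# 5) _ 3≤t
  c₆ : ℕ
  c₆ = l (# 5) (proj₁ F₆)

  F₅ : Fresh (# 4) (c₆ ∷ c₈ ∷ [])
  F₅ = fresh (# 4) _ 3≤t
  c₅ : ℕ
  c₅ = l (# 4) (proj₁ F₅)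

  F₂ : Fresh (# 1) (c₅ ∷ c₇ ∷ [])
  F₂ = fresh (# 1) _ 3≤t
  c₂ : ℕ
  c₂ = l (# 1) (proj₁ F₂)

  F₃ : Fresh (# 2) (c₂ ∷ c₆ ∷ [])
  F₃ = fresh (# 2) _ 3≤t
  c₃ : ℕ
  c₃ = l (# 2) (proj₁ F₃)

  F₄ : Fresh (# 3) (c₃ ∷ c₇ ∷ [])
  F₄ = fresh (# 3) _ 3≤t
  c₄ : ℕ
  c₄ = l (# 3) (proj₁ F₄)

middle-part : Subset 8
middle-part = outside ∷ inside ∷ inside ∷ inside ∷ inside ∷ inside ∷ inside ∷ outside ∷ []

middle-colouring : ∀ {t} (l : Fin 8 → Fin t → ℕ) → (∀ j → Injective _≡_ _≡_ (l j)) → 3 ≤ t →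
                   GadgetColouringWithoutV₈ l 6
middle-colouring {t} l l-inj 3≤t =
  record { part = middle-part ; size = ≤-refl ; choice = greedy-choice ; proper = greedy-proper } , λ ()
  where
  q : Fin t
  q = fromℕ< (≤-trans (s≤s z≤n) 3≤t)
  -- v₁ and v₈ are left out; v₈ still gets a colour q, which v₅, v₆ and v₇ avoid
  open Greedy l l-inj 3≤t q
  greedy-choice : Fin 8 → Fin t
  greedy-choice = lookup (q ∷ proj₁ F₂ ∷ proj₁ F₃ ∷ proj₁ F₄ ∷ proj₁ F₅ ∷ proj₁ F₆ ∷ proj₁ F₇ ∷ q ∷ [])
  greedy-proper : ProperOn l middle-part greedy-choice
  greedy-proper e12 () _
  greedy-proper e13 () _
  greedy-proper e14 () _
  greedy-proper e23 _ _ = ≢-sym (head (proj₂ F₃))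
  greedy-proper e34 _ _ = ≢-sym (head (proj₂ F₄))
  greedy-proper e25 _ _ = head (proj₂ F₂)
  greedy-proper e36 _ _ = head (tail (proj₂ F₃))
  greedy-proper e47 _ _ = head (tail (proj₂ F₄))
  greedy-proper e27 _ _ = head (tail (proj₂ F₂))
  greedy-proper e56 _ _ = head (proj₂ F₅)
  greedy-proper e67 _ _ = head (proj₂ F₆)
  greedy-proper e58 _ ()
  greedy-proper e68 _ ()
  greedy-proper e78 _ ()

full-colouring : ∀ {t} (l : Fin 8 → Fin t → ℕ) → (∀ j → Injective _≡_ _≡_ (l j)) → 4 ≤ t →
                 Fin t → GadgetColouring l 8
full-colouring {t} l l-inj 4≤t q₈ =
  record { part = ⊤ ; size = ≤-refl ; choice = greedy-choice ; proper = greedy-proper }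
  where
  open Greedy l l-inj (≤-trans (n≤1+n 3) 4≤t) q₈
  F₁ : Fresh (# 0) (c₂ ∷ c₃ ∷ c₄ ∷ [])
  F₁ = fresh (# 0) _ 4≤t
  greedy-choice : Fin 8 → Fin t
  greedy-choice = lookup (proj₁ F₁ ∷ proj₁ F₂ ∷ proj₁ F₃ ∷ proj₁ F₄ ∷ proj₁ F₅ ∷ proj₁ F₆ ∷ proj₁ F₇ ∷ q₈ ∷ [])
  greedy-proper : ProperOn l ⊤ greedy-choice
  greedy-proper e12 _ _ = head (proj₂ F₁)
  greedy-proper e13 _ _ = head (tail (proj₂ F₁))
  greedy-proper e14 _ _ = head (tail (tail (proj₂ F₁)))
  greedy-proper e23 _ _ = ≢-sym (head (proj₂ F₃))
  greedy-proper e34 _ _ = ≢-sym (head (proj₂ F₄))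
  greedy-proper e25 _ _ = head (proj₂ F₂)
  greedy-proper e36 _ _ = head (tail (proj₂ F₃))
  greedy-proper e47 _ _ = head (tail (proj₂ F₄))
  greedy-proper e27 _ _ = head (tail (proj₂ F₂))
  greedy-proper e56 _ _ = head (proj₂ F₅)
  greedy-proper e67 _ _ = head (proj₂ F₆)
  greedy-proper e58 _ _ = head (tail (proj₂ F₅))
  greedy-proper e68 _ _ = head (tail (proj₂ F₆))
  greedy-proper e78 _ _ = head (proj₂ F₇)

part-A part-B : Subset 8
part-A = inside ∷ inside ∷ outside ∷ inside ∷ inside ∷ inside ∷ inside ∷ outside ∷ []
part-B = inside ∷ inside ∷ inside ∷ inside ∷ inside ∷ outside ∷ inside ∷ outside ∷ []

module TwoLists (l : Fin 8 → Fin 2 → ℕ) (l-inj : ∀ j → Injective _≡_ _≡_ (l j)) where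

  colouring-of-A : (k₁ k₂ k₄ k₅ k₆ k₇ : Fin 2) →
    l (# 0) k₁ ≢ l (# 1) k₂ → l (# 0) k₁ ≢ l (# 3) k₄ → l (# 1) k₂ ≢ l (# 4) k₅ →
    l (# 3) k₄ ≢ l (# 6) k₇ → l (# 1) k₂ ≢ l (# 6) k₇ → l (# 4) k₅ ≢ l (# 5) k₆ →
    l (# 5) k₆ ≢ l (# 6) k₇ → GadgetColouringWithoutV₈ l 6
  colouring-of-A k₁ k₂ k₄ k₅ k₆ k₇ ne12 ne14 ne25 ne47 ne27 ne56 ne67 =
    record { part = part-A ; size = ≤-refl ; choice = choice-A ; proper = proper-A } , λ ()
    where
    choice-A : Fin 8 → Fin 2
    choice-A = lookup (k₁ ∷ k₂ ∷ zero ∷ k₄ ∷ k₅ ∷ k₆ ∷ k₇ ∷ zero ∷ [])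
    proper-A : ProperOn l part-A choice-A
    proper-A e12 _ _ = ne12
    proper-A e13 _ ()
    proper-A e14 _ _ = ne14
    proper-A e23 _ ()
    proper-A e34 () _
    proper-A e25 _ _ = ne25
    proper-A e36 () _
    proper-A e47 _ _ = ne47
    proper-A e27 _ _ = ne27
    proper-A e56 _ _ = ne56
    proper-A e67 _ _ = ne67
    proper-A e58 _ ()
    proper-A e68 _ ()
    proper-A e78 _ ()

  colouring-of-B : (k₁ k₂ k₃ k₄ k₅ k₇ : Fin 2) →
    l (# 0) k₁ ≢ l (# 1) k₂ → l (# 0) k₁ ≢ l (# 2) k₃ → l (# 0) k₁ ≢ l (# 3) k₄ →
    l (# 1) k₂ ≢ l (# 2) k₃ → l (# 2) k₃ ≢ l (# 3) k₄ → l (# 1) k₂ ≢ l (# 4) k₅ →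
    l (# 3) k₄ ≢ l (# 6) k₇ → l (# 1) k₂ ≢ l (# 6) k₇ → GadgetColouringWithoutV₈ l 6
  colouring-of-B k₁ k₂ k₃ k₄ k₅ k₇ ne12 ne13 ne14 ne23 ne34 ne25 ne47 ne27 =
    record { part = part-B ; size = ≤-refl ; choice = choice-B ; proper = proper-B } , λ ()
    where
    choice-B : Fin 8 → Fin 2
    choice-B = lookup (k₁ ∷ k₂ ∷ k₃ ∷ k₄ ∷ k₅ ∷ zero ∷ k₇ ∷ zero ∷ [])
    proper-B : ProperOn l part-B choice-B
    proper-B e12 _ _ = ne12
    proper-B e13 _ _ = ne13
    proper-B e14 _ _ = ne14
    proper-B e23 _ _ = ne23
    proper-B e34 _ _ = ne34
    proper-B e25 _ _ = ne25
    proper-B e36 _ ()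
    proper-B e47 _ _ = ne47
    proper-B e27 _ _ = ne27
    proper-B e56 _ ()
    proper-B e67 () _
    proper-B e58 _ ()
    proper-B e68 _ ()
    proper-B e78 _ ()

  Blocked₁₄ Blocked₅₆ : ℕ → ℕ → Set
  Blocked₁₄ = PathBlocked (l (# 0)) (l (# 3))
  Blocked₅₆ = PathBlocked (l (# 4)) (l (# 5))

  colouring-of-A-or-blocked : (i j : Fin 2) → l (# 1) i ≢ l (# 6) j →
    GadgetColouringWithoutV₈ l 6 ⊎ (Blocked₁₄ (l (# 1) i) (l (# 6) j) ⊎ Blocked₅₆ (l (# 1) i) (l (# 6) j))
  colouring-of-A-or-blocked i j ne27
    with path-colouring-or-blocked (l-inj (# 0)) (l-inj (# 3)) (l (# 1) i) (l (# 6) j)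
       | path-colouring-or-blocked (l-inj (# 4)) (l-inj (# 5)) (l (# 1) i) (l (# 6) j)
  ... | inj₂ blocked | _ = inj₂ (inj₁ blocked)
  ... | inj₁ _ | inj₂ blocked = inj₂ (inj₂ blocked)
  ... | inj₁ (k₁ , k₄ , ne12 , ne14 , ne47) | inj₁ (k₅ , k₆ , ne25 , ne56 , ne67) =
    inj₁ (colouring-of-A k₁ i k₄ k₅ k₆ j ne12 ne14 (≢-sym ne25) ne47 ne27 ne56 ne67)

  -- With L(v₁) = {x, a} and L(v₄) = {x', a}, colour B by v₂ ↦ x', v₇ ↦ x, v₄ ↦ x'
  -- and v₁ ↦ x, or v₁ ↦ a when v₃ must take x.
  colouring-of-B-when-blocked : ∀ {i j} → Blocked₁₄ (l (# 6) j) (l (# 1) i) → l (# 1) i ≢ l (# 6) j →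
                                GadgetColouringWithoutV₈ l 6
  colouring-of-B-when-blocked {i} {j} (k , m , l₁k≡x , l₄m≡x' , shared) x'≢x
    with fresh-colour₁ (l-inj (# 4)) ≤-refl (l (# 1) i) | fresh-colour₁ (l-inj (# 2)) ≤-refl (l (# 1) i)
  ... | k₅ , c₅≢x' | k₃ , c₃≢x' with l (# 2) k₃ ≟ l (# 6) j
  ...   | no c₃≢x =
    colouring-of-B k i k₃ m k₅ j
      (λ e → x'≢x (trans (sym e) l₁k≡x)) (λ e → c₃≢x (trans (sym e) l₁k≡x))
      (λ e → x'≢x (trans (sym l₄m≡x') (trans (sym e) l₁k≡x))) (≢-sym c₃≢x')
      (λ e → c₃≢x' (trans e l₄m≡x')) (≢-sym c₅≢x') (λ e → x'≢x (trans (sym l₄m≡x') e)) x'≢x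
  ...   | yes c₃≡x =
    colouring-of-B (opposite k) i k₃ m k₅ j
      (λ e → opposite-≢ m (l-inj (# 3) (trans (sym shared) (trans e (sym l₄m≡x')))))
      (λ e → opposite-≢ k (l-inj (# 0) (trans e (trans c₃≡x (sym l₁k≡x)))))
      (λ e → opposite-≢ m (l-inj (# 3) (trans (sym shared) e)))
      (λ e → x'≢x (trans e c₃≡x)) (λ e → x'≢x (trans (sym l₄m≡x') (trans (sym e) c₃≡x)))
      (≢-sym c₅≢x') (λ e → x'≢x (trans (sym l₄m≡x') e)) x'≢x

  colouring-avoiding-blocked-pairs :
    ∀ {x y x' y'} → Blocked₁₄ x y → Blocked₅₆ x' y' →
    (i j : Fin 2) → l (# 1) i ≢ l (# 6) j →
    l (# 1) i ≢ x ⊎ l (# 6) j ≢ y → l (# 1) i ≢ x' ⊎ l (# 6) j ≢ y' → GadgetColouringWithoutV₈ l 6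
  colouring-avoiding-blocked-pairs blocked blocked' i j ne27 new new'
    with colouring-of-A-or-blocked i j ne27
  ... | inj₁ g = g
  ... | inj₂ (inj₁ b) = ⊥-elim (≢-in-a-coordinate new (path-blocked-unique (l-inj (# 0)) blocked b ne27))
  ... | inj₂ (inj₂ b) = ⊥-elim (≢-in-a-coordinate new' (path-blocked-unique (l-inj (# 4)) blocked' b ne27))

  -- (x, y) is blocked by one path and (x', y') by the other: then either some
  -- third pair is free, or L(v₇) = {x, x'} with y = x' and B is colourable.
  colouring-when-both-paths-block : ∀ {i i' j j'} → l (# 1) i ≢ l (# 1) i' →
    Blocked₁₄ (l (# 1) i) (l (# 6) j) → Blocked₅₆ (l (# 1) i') (l (# 6) j') → GadgetColouringWithoutV₈ l 6
  colouring-when-both-paths-block {i} {i'} {j} {j'} x≢x' blocked blocked'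
    with l (# 6) (opposite j) ≟ l (# 1) i
  ... | no z≢x = colouring-avoiding-blocked-pairs blocked blocked' i (opposite j)
                   (≢-sym z≢x) (inj₂ (opposite-≢ j ∘ l-inj (# 6))) (inj₁ x≢x')
  ... | yes z≡x with l (# 6) j ≟ l (# 1) i'
  ...   | yes y≡x' = colouring-of-B-when-blocked (subst₂ Blocked₁₄ (sym z≡x) y≡x' blocked)
                       (λ e → x≢x' (trans (sym z≡x) (sym e)))
  ...   | no y≢x' with l (# 6) j ≟ l (# 6) j'
  ...     | yes y≡y' = colouring-avoiding-blocked-pairs blocked blocked' i' (opposite j)
                         (λ e → x≢x' (trans (sym z≡x) (sym e))) (inj₁ (≢-sym x≢x'))
                         (inj₂ (λ e → opposite-≢ j (l-inj (# 6) (trans e (sym y≡y')))))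
  ...     | no y≢y' = colouring-avoiding-blocked-pairs blocked blocked' i' j
                        (≢-sym y≢x') (inj₁ (≢-sym x≢x')) (inj₂ y≢y')

  v₂-colours-distinct : l (# 1) zero ≢ l (# 1) (suc zero)
  v₂-colours-distinct = 0≢1+n ∘ l-inj (# 1)

  two-list-colouring : GadgetColouringWithoutV₈ l 6
  two-list-colouring
    with fresh-colour₁ (l-inj (# 6)) ≤-refl (l (# 1) zero)
       | fresh-colour₁ (l-inj (# 6)) ≤-refl (l (# 1) (suc zero))
  ... | j₀ , y₀≢x₀ | j₁ , y₁≢x₁
    with colouring-of-A-or-blocked zero j₀ (≢-sym y₀≢x₀) | colouring-of-A-or-blocked (suc zero) j₁ (≢-sym y₁≢x₁)
  ... | inj₁ g | _ = g
  ... | inj₂ _ | inj₁ g = g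
  ... | inj₂ (inj₁ b₀) | inj₂ (inj₁ b₁) = ⊥-elim (v₂-colours-distinct (proj₁ (path-blocked-unique (l-inj (# 0)) b₀ b₁ (≢-sym y₁≢x₁))))
  ... | inj₂ (inj₂ b₀) | inj₂ (inj₂ b₁) = ⊥-elim (v₂-colours-distinct (proj₁ (path-blocked-unique (l-inj (# 4)) b₀ b₁ (≢-sym y₁≢x₁))))
  ... | inj₂ (inj₁ b₀) | inj₂ (inj₂ b₁) = colouring-when-both-paths-block v₂-colours-distinct b₀ b₁
  ... | inj₂ (inj₂ b₀) | inj₂ (inj₁ b₁) = colouring-when-both-paths-block (≢-sym v₂-colours-distinct) b₁ b₀

∣∣-++ : ∀ {m n} (p : Subset m) (q : Subset n) → ∣ p ++ q ∣ ≡ ∣ p ∣ + ∣ q ∣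
∣∣-++ []            q = refl
∣∣-++ (true  ∷ p) q = cong suc (∣∣-++ p q)
∣∣-++ (false ∷ p) q = ∣∣-++ p q

∣concat∣-≥ : ∀ {m k} r (ps : Fin r → Subset m) → (∀ i → k ≤ ∣ ps i ∣) → r * k ≤ ∣ concat (tabulate ps) ∣
∣concat∣-≥ zero    ps k≤ = z≤n
∣concat∣-≥ (suc r) ps k≤ rewrite ∣∣-++ (ps zero) (concat (tabulate (ps ∘ suc))) =
  +-mono-≤ (k≤ zero) (∣concat∣-≥ r (ps ∘ suc) (k≤ ∘ suc))

gadget-lists : ∀ {r t} → Assignment (H r) t → Fin r → Fin 8 → Fin t → ℕ
gadget-lists L i j = list L (combine i j)

gadget-lists-injective : ∀ {r t} (L : Assignment (H r) t) i j → Injective _≡_ _≡_ (gadget-lists L i j)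
gadget-lists-injective L i j = distinct L (combine i j)

record BlockColouring {r t : ℕ} (L : Assignment (H r) t) (k : ℕ) : Set where
  field
    gadget : (i : Fin r) → GadgetColouring (gadget-lists L i) k
    connectors-proper : ∀ i i' → toℕ i' ≡ suc (toℕ i) →
      lookup (part (gadget i)) (# 7) ≡ inside → lookup (part (gadget i')) (# 7) ≡ inside →
      gadget-lists L i (# 7) (choice (gadget i) (# 7)) ≢ gadget-lists L i' (# 7) (choice (gadget i') (# 7))

module _ {r t k : ℕ} {L : Assignment (H r) t} (B : BlockColouring L k) where
  open BlockColouring B

  block-part : Subset (r * 8)
  block-part = concat (tabulate (part ∘ gadget))

  block-choice : Fin (r * 8) → Fin t
  block-choice v = uncurry (choice ∘ gadget) (remQuot 8 v)

  block-colour : Fin (r * 8) → ℕ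
  block-colour v = list L v (block-choice v)

  block-colour-combine : ∀ i j → block-colour (combine i j) ≡ gadget-lists L i j (choice (gadget i) j)
  block-colour-combine i j = cong (list L (combine i j)) (cong (uncurry (choice ∘ gadget)) (remQuot-combine i j))

  ∈-block-part : ∀ {i j} → combine i j ∈ block-part → lookup (part (gadget i)) j ≡ inside
  ∈-block-part {i} {j} v∈ = begin
    lookup (part (gadget i)) j                     ≡⟨ cong (λ p → lookup p j) (lookup∘tabulate (part ∘ gadget) i) ⟨
    lookup (lookup (tabulate (part ∘ gadget)) i) j ≡⟨ lookup-concat (tabulate (part ∘ gadget)) i j ⟨
    lookup block-part (combine i j)                ≡⟨ []=⇒lookup v∈ ⟩
    inside                                         ∎
    where open ≡-Reasoning

  block-colour-proper : ∀ {u v} → HEdge r u v → u ∈ block-part → v ∈ block-part → block-colour u ≢ block-colour v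
  block-colour-proper (inner i j j' e) u∈ v∈ =
    subst₂ _≢_ (sym (block-colour-combine i j)) (sym (block-colour-combine i j'))
      (proper (gadget i) e (∈-block-part u∈) (∈-block-part v∈))
  block-colour-proper (outer i i' i'≡1+i) u∈ v∈ =
    subst₂ _≢_ (sym (block-colour-combine i (# 7))) (sym (block-colour-combine i' (# 7)))
      (connectors-proper i i' i'≡1+i (∈-block-part u∈) (∈-block-part v∈))

  induced-colouring : ∃[ S ] (r * k ≤ ∣ S ∣ × InducedListColourable (H r) L S)
  induced-colouring =
    block-part , ∣concat∣-≥ r (part ∘ gadget) (size ∘ gadget) ,
    block-colour , (λ v _ → block-choice v , refl) , adjacent-proper
    where
    adjacent-proper : ∀ u v → u ∈ block-part → v ∈ block-part → Adj (H r) u v → block-colour u ≢ block-colour v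
    adjacent-proper u v u∈ v∈ (inj₁ uv) = block-colour-proper uv u∈ v∈
    adjacent-proper u v u∈ v∈ (inj₂ vu) = ≢-sym (block-colour-proper vu v∈ u∈)

isolated-gadgets : ∀ {r t k} {L : Assignment (H r) t} →
                   (∀ i → GadgetColouringWithoutV₈ (gadget-lists L i) k) → BlockColouring L k
isolated-gadgets g = record
  { gadget = proj₁ ∘ g
  ; connectors-proper = λ i _ _ v₈∈ _ → ⊥-elim (proj₂ (g i) v₈∈)
  }

ConsecutiveDistinct : ∀ {r t} → (Fin r → Fin t → ℕ) → (Fin r → Fin t) → Set
ConsecutiveDistinct {r} ℓ k = ∀ (i i' : Fin r) → toℕ i' ≡ suc (toℕ i) → ℓ i (k i) ≢ ℓ i' (k i')

path-colouring : ∀ {t} r (ℓ : Fin r → Fin t → ℕ) → (∀ i → Injective _≡_ _≡_ (ℓ i)) → 2 ≤ t →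
                 Σ[ k ∈ (Fin r → Fin t) ] ConsecutiveDistinct ℓ k
path-colouring zero          ℓ ℓ-inj 2≤t = (λ ()) , λ ()
path-colouring (suc zero)    ℓ ℓ-inj 2≤t = (λ _ → fromℕ< (≤-trans (s≤s z≤n) 2≤t)) , λ { zero zero () }
path-colouring {t} (suc (suc r)) ℓ ℓ-inj 2≤t with path-colouring (suc r) (ℓ ∘ suc) (ℓ-inj ∘ suc) 2≤t
... | k , k-distinct with fresh-colour₁ (ℓ-inj zero) 2≤t (ℓ (suc zero) (k zero))
...   | k₀ , k₀-fresh = extended , extended-distinct
  where
  extended : Fin (suc (suc r)) → Fin t
  extended zero    = k₀
  extended (suc i) = k i
  extended-distinct : ConsecutiveDistinct ℓ extended
  extended-distinct zero    (suc zero)    refl      = k₀-fresh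
  extended-distinct (suc i) (suc i')      i'≡1+i    = k-distinct i i' (suc-injective i'≡1+i)
  extended-distinct zero    zero          ()
  extended-distinct zero    (suc (suc _)) ()
  extended-distinct (suc _) zero          ()

full-block-colouring : ∀ {r t} → 4 ≤ t → (L : Assignment (H r) t) → BlockColouring L 8
full-block-colouring {r} {t} 4≤t L = record
  { gadget = λ i → full-colouring (gadget-lists L i) (gadget-lists-injective L i) 4≤t (proj₁ v₈-choices i)
  ; connectors-proper = λ i i' i'≡1+i _ _ → proj₂ v₈-choices i i' i'≡1+i
  }
  where
  v₈-choices : Σ[ k ∈ (Fin r → Fin t) ] ConsecutiveDistinct (λ i → gadget-lists L i (# 7)) k
  v₈-choices = path-colouring r (λ i → gadget-lists L i (# 7)) (λ i → gadget-lists-injective L i (# 7))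
                        (≤-trans (n≤1+n 2) (≤-trans (n≤1+n 3) 4≤t))

binary-lists : ∀ {n} (G : Graph n) → Assignment G 2
binary-lists G = record { list = λ _ → toℕ ; distinct = λ _ → toℕ-injective }

not-2-choosable : ∀ {r} → 1 ≤ r → ¬ Choosable (H r) 2
not-2-choosable {suc r} _ choosable with choosable (binary-lists (H (suc r)))
... | _ , from-list , proper =
  chosen-≢ e23 (Fin2-≢-unique (chosen (# 0)) (chosen (# 1)) (chosen (# 2))
                           (≢-sym (chosen-≢ e12)) (≢-sym (chosen-≢ e13)))
  where
  chosen : Fin 8 → Fin 2
  chosen j = proj₁ (from-list (combine {suc r} zero j))
  chosen-≢ : ∀ {j j'} → E8 j j' → chosen j ≢ chosen j'
  chosen-≢ {j} {j'} e same = proper (combine {suc r} zero j) (combine {suc r} zero j') (inj₁ (inner zero j j' e))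
    (trans (proj₂ (from-list _)) (trans (cong toℕ same) (sym (proj₂ (from-list _)))))

choosable-H⇒3≤ : ∀ {r s} → 1 ≤ r → Choosable (H r) s → 2 ≤ s → 3 ≤ s
choosable-H⇒3≤ {s = 1}                   _   _          (s≤s ())
choosable-H⇒3≤ {s = 2}                   1≤r choosable _ = ⊥-elim (not-2-choosable 1≤r choosable)
choosable-H⇒3≤ {s = suc (suc (suc s))} _   _          _ = s≤s (s≤s (s≤s z≤n))

gadget-count : ∀ {t s k} r → t * 8 ≤ s * k → t * (r * 8) ≤ s * (r * k)
gadget-count {t} {s} {k} r t8≤sk = begin
  t * (r * 8) ≡⟨ x∙yz≈y∙xz t r 8 ⟩
  r * (t * 8) ≤⟨ *-monoʳ-≤ r t8≤sk ⟩
  r * (s * k) ≡⟨ x∙yz≈y∙xz r s k ⟩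
  s * (r * k) ∎
  where open ≤-Reasoning

lambda-bound : ∀ {r t s} k → t * 8 ≤ s * k → ((L : Assignment (H r) t) → BlockColouring L k) →
               LambdaAtLeastRatio (H r) t (t * (r * 8)) s
lambda-bound {r} {t} {s} k t8≤sk colouring L with induced-colouring (colouring L)
... | S , rk≤∣S∣ , S-colourable = S , ≤-trans (gadget-count {t} {s} {k} r t8≤sk) (*-monoʳ-≤ s rk≤∣S∣) , S-colourable

mainTheorem14 : (r : ℕ) → 1 ≤ r → (s : ℕ) → IsListChromaticNumber (H r) s →
                (t : ℕ) → 1 ≤ t → t < s →
                LambdaAtLeastRatio (H r) t (t * (r * 8)) s
mainTheorem14 _ _   _ _               0 () _
mainTheorem14 r 1≤r s (choosable , _) 1 _ 1<s =
  lambda-bound {s = s} 3 (≤-trans (n≤1+n 8) (*-monoˡ-≤ 3 (choosable-H⇒3≤ 1≤r choosable 1<s)))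
    λ L → isolated-gadgets λ i → independent-colouring (gadget-lists L i)
mainTheorem14 r _ s _ 2 _ 2<s =
  lambda-bound {s = s} 6 (≤-trans (m≤m+n 16 2) (*-monoˡ-≤ 6 2<s))
    λ L → isolated-gadgets λ i → TwoLists.two-list-colouring (gadget-lists L i) (gadget-lists-injective L i)
mainTheorem14 r _ s _ 3 _ 3<s =
  lambda-bound {s = s} 6 (*-monoˡ-≤ 6 3<s)
    λ L → isolated-gadgets λ i → middle-colouring (gadget-lists L i) (gadget-lists-injective L i) ≤-refl
mainTheorem14 r _ s _ (suc (suc (suc (suc _)))) _ t<s =
  lambda-bound {s = s} 8 (*-monoˡ-≤ 8 (<⇒≤ t<s)) (full-block-colouring (s≤s (s≤s (s≤s (s≤s z≤n)))))
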